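{- Let $z_2\in\mathbb{Z}$ be a multiple of $400$, let $e_2=(z_2,3,1)$, $G_2=\{x\in G: x\ge e_2\}$, let $\rho_2$ be the rata die function on $G_2$ with epoch $e_2$ and $\rho_3$ the rata die function on $G_2$ with epoch $e_3$, where $e_3\in G_2$. Given $(y_2,m_2,d_2)\in G_2$, set $y_1=y_2-z_2$, $m_1=m_2$, $d_1=d_2$; $y_0=y_1-\mathbf 1_{\{m_1\le2\}}$, $m_0=m_1+12\cdot\mathbf 1_{\{m_1\le2\}}$, $d_0=d_1-1$; $q_1=y_0/100$, $y_c=1461\cdot y_0/4-q_1+q_1/4$, $m_c=(979\cdot m_0-2919)/2^5$, $d_c=d_0$. Then $\rho_3(y_2,m_2,d_2)=y_c+m_c+d_c-\rho_2(e_3)$.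
   Context: For $n,\delta\in\mathbb{Z}$ with $\delta\neq0$, $n/\delta$ and $n\%\delta$ denote Euclidean quotient and remainder ($n=q\delta+s$, $0\le s<|\delta|$); $\cdot$, $/$, $\%$ have equal precedence and associate left to right. $\mathbf 1_{\{P\}}$ is $1$ if $P$ holds and $0$ otherwise. $\mathbb{Z}^3$ carries the lexicographic order. A year $y$ is a leap year if ($y\%4=0$ and $y\%100\ne0$) or $y\%400=0$. The (proleptic) Gregorian calendar is $G=\{(y,m,d)\in\mathbb{Z}^3: m\in\{1,\dots,12\},\ 1\le d\le L(y,m)\}$ where $L(y,m)=31$ for $m\in\{1,3,5,7,8,10,12\}$, $L(y,m)=30$ for $m\in\{4,6,9,11\}$, and $L(y,2)=29$ if $y$ is a leap year and $28$ otherwise. For a subset $C\subset\mathbb{Z}^3$ (all of whose bounded intervals are finite) and $e\in C$, the rata die function with epoch $e$ is $\rho:C\to\mathbb{Z}$, $\rho(x)=\#\{z\in C: e\le z<x\}$ if $x\ge e$ and $\rho(x)=-\#\{z\in C: x\le z<e\}$ if $x<e$. -}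

module Defs where

open import Data.Bool using (Bool; true; false; _∧_; _∨_; not; if_then_else_; T)
open import Data.Nat as ℕ using (ℕ)
open import Data.Integer using (ℤ; +_; _+_; _-_; _*_; -_; _%_; _≤ᵇ_; _⊓_; _⊔_; ∣_∣)
open import Data.List using (List; []; _∷_; concatMap; map; filter; filterᵇ; length)
open import Data.Product using (_×_; _,_; proj₁; proj₂)
open import Relation.Binary.PropositionalEquality using (_≡_)

-- Triples in ℤ³ (year, month, day)
Date : Set
Date = ℤ × ℤ × ℤ

yr : Date → ℤ
yr (y , _ , _) = y

_<ᵇ_ : ℤ → ℤ → Bool
a <ᵇ b = (a + + 1) ≤ᵇ b

infix 4 _==_ _<ᵇ_ _<ₗ_ _≤ₗ_
_==_ : ℤ → ℤ → Bool
a == b = (a ≤ᵇ b) ∧ (b ≤ᵇ a)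

_<ₗ_ : Date → Date → Bool
(a , b , c) <ₗ (a' , b' , c') =
  (a <ᵇ a') ∨ ((a == a') ∧ ((b <ᵇ b') ∨ ((b == b') ∧ (c <ᵇ c'))))

_≤ₗ_ : Date → Date → Bool
x ≤ₗ y = not (y <ₗ x)

-- Gregorian leap year (% is Euclidean remainder, returning ℕ)
isLeap : ℤ → Bool
isLeap y = ((y % + 4 ℕ.≡ᵇ 0) ∧ not (y % + 100 ℕ.≡ᵇ 0)) ∨ (y % + 400 ℕ.≡ᵇ 0)

monthLength : ℤ → ℤ → ℤ
monthLength y m =
  if (m == + 2) then (if isLeap y then + 29 else + 28)
  else if ((m == + 4) ∨ (m == + 6) ∨ (m == + 9) ∨ (m == + 11)) then + 30
  else + 31

inGᵇ : Date → Bool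
inGᵇ (y , m , d) = (+ 1 ≤ᵇ m) ∧ (m ≤ᵇ + 12) ∧ (+ 1 ≤ᵇ d) ∧ (d ≤ᵇ monthLength y m)

InG : Date → Set
InG x = T (inGᵇ x)

inGgeᵇ : Date → Date → Bool
inGgeᵇ e x = inGᵇ x ∧ (e ≤ₗ x)

intRange : ℤ → ℕ → List ℤ
intRange a ℕ.zero    = []
intRange a (ℕ.suc n) = a ∷ intRange (a + + 1) n

-- all triples (y,m,d) with lo ≤ y ≤ hi, 1 ≤ m ≤ 12, 1 ≤ d ≤ 31
-- (a finite superset of every bounded interval of G whose endpoints have years in [lo,hi])
candidates : ℤ → ℤ → List Date
candidates lo hi =
  concatMap (λ y → concatMap (λ m → map (λ d → (y , m , d)) (intRange (+ 1) 31))
                               (intRange (+ 1) 12))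
            (intRange lo (ℕ.suc ∣ hi - lo ∣))

countInterval : (Date → Bool) → Date → Date → ℕ
countInterval C a b =
  length (filterᵇ (λ z → C z ∧ (a ≤ₗ z) ∧ (z <ₗ b))
                  (candidates (yr a ⊓ yr b) (yr a ⊔ yr b)))

rataDie : (Date → Bool) → Date → Date → ℤ
rataDie C e x =
  if e ≤ₗ x then + countInterval C e x
  else - (+ countInterval C x e)

ind≤2 : ℤ → ℤ
ind≤2 m = if m ≤ᵇ + 2 then + 1 else + 0

-- the formula y_c + m_c + d_c of the proposition (integer / is Euclidean)
formula : ℤ → Date → ℤ
formula z₂ (y₂ , m₂ , d₂) =
  let y₁ = y₂ - z₂ ; m₁ = m₂ ; d₁ = d₂
      y₀ = y₁ - ind≤2 m₁ ; m₀ = m₁ + + 12 * ind≤2 m₁ ; d₀ = d₁ - + 1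
      q₁ = y₀ Data.Integer./ + 100
      y_c = (+ 1461 * y₀) Data.Integer./ + 4 - q₁ + q₁ Data.Integer./ + 4
      m_c = (+ 979 * m₀ - + 2919) Data.Integer./ + 32
      d_c = d₀
  in y_c + m_c + d_c

module Submission where

-- Counting the dates of G₂ from the epoch e₂ = (z₂, 3, 1), the count grows by exactly one from a
-- date to the next calendar day, because no date of G lies strictly between them.  So does
-- y_c + m_c + d_c: within a month trivially, at the end of every month but February by arithmetic on
-- numerals, and at the end of February by y_c(Y + 1) = y_c(Y) + 365 + [Y + 1 is leap], an identity
-- invariant under Y ↦ Y + 400 and hence a finite check.  Every date of G₂ is reached from e₂ by such
-- steps, so ρ₂ = y_c + m_c + d_c; counts over adjacent intervals add, which gives ρ₃ = ρ₂ − ρ₂(e₃).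

open import Data.Bool using (Bool; true; false; T; not; _∧_; _∨_; if_then_else_)
open import Data.Bool.Properties using (T-∧; T-∨; T-≡)
open import Data.Empty using (⊥)
open import Data.Integer hiding (suc)
open import Data.Integer.DivMod using (a≡a%n+[a/n]*n; n%d<d)
open import Data.Integer.Divisibility using (_∣_)
open import Data.Integer.Divisibility.Signed using (divides; ∣ᵤ⇒∣)
open import Data.Integer.Properties
open import Algebra.Properties.AbelianGroup +-0-abelianGroup using (∙-cancelʳ)
open import Data.Integer.Tactic.RingSolver using (solve-∀; solve)
open import Data.List using (List; []; _∷_; _++_; length; filterᵇ; map; concatMap; upTo)
open import Data.List.Membership.Propositional.Properties using (∈-upTo⁺)
open import Data.List.Properties using (filter-++; length-++; filter-none; filter-≐; map-cong)
open import Data.List.Relation.Unary.All as All using (All; all?)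
open import Data.Nat as ℕ using (ℕ; zero; suc)
import Data.Nat.Properties as ℕ
open import Data.Nat.ListAction using (sum)
open import Data.Product using (_×_; _,_; proj₁; proj₂)
open import Data.Product.Function.NonDependent.Propositional using (_×-⇔_)
open import Data.Product.Relation.Binary.Lex.Strict using (×-Lex; ×-transitive; ×-compare)
open import Data.Sum as Sum using (_⊎_; inj₁; inj₂)
open import Data.Sum.Function.Propositional using (_⊎-⇔_)
open import Function using (_⇔_; mk⇔; Equivalence; _∘_)
open import Function.Construct.Composition using (_⇔-∘_)
open import Function.Construct.Identity using (⇔-id)
open import Relation.Binary using (Tri; tri<; tri≈; tri>)
open import Relation.Binary.PropositionalEquality
open import Relation.Nullary using (¬_; contradiction; yes; no)
open import Relation.Nullary.Decidable using (T?; toWitness)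

open import Defs

open Equivalence using (to; from)

quotient-≤ : ∀ {n q q' r r'} → r ℕ.< n → + r + q * + n ≡ + r' + q' * + n → q' ≤ q
quotient-≤ {n} {q} {q'} {r} {r'} r<n eq = ≮⇒≥ λ q<q' → <-irrefl refl (begin-strict
  (+ 1 + q) * + n  ≤⟨ *-monoʳ-≤-nonNeg (+ n) (i<j⇒suc[i]≤j q<q') ⟩
  q' * + n         ≤⟨ i≤j+i _ (+ r') ⟩
  + r' + q' * + n  ≡⟨ eq ⟨
  + r + q * + n    <⟨ +-monoˡ-< (q * + n) (+<+ r<n) ⟩
  + n + q * + n    ≡⟨ suc-* q (+ n) ⟨
  (+ 1 + q) * + n  ∎)
  where open ≤-Reasoning

div-mod-unique : ∀ {n} .{{_ : ℕ.NonZero n}} {a q r} → r ℕ.< n → a ≡ + r + q * + n →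
                 a / + n ≡ q × a % + n ≡ r
div-mod-unique {n} {a = a} {q} {r} r<n a≡ = quotient , remainder
  where
  a≡' : + (a % + n) + (a / + n) * + n ≡ + r + q * + n
  a≡' = trans (sym (a≡a%n+[a/n]*n a (+ n))) a≡
  quotient : a / + n ≡ q
  quotient = ≤-antisym (quotient-≤ r<n (sym a≡')) (quotient-≤ (n%d<d a (+ n)) a≡')
  remainder : a % + n ≡ r
  remainder = +-injective (∙-cancelʳ (q * + n) _ _
    (trans (cong (λ q → + (a % + n) + q * + n) (sym quotient)) a≡'))

module _ {n} .{{_ : ℕ.NonZero n}} (a t : ℤ) where

  private
    a+tn≡ : a + t * + n ≡ + (a % + n) + (a / + n + t) * + n
    a+tn≡ = begin
      a + t * + n                                   ≡⟨ cong (_+ t * + n) (a≡a%n+[a/n]*n a (+ n)) ⟩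
      + (a % + n) + (a / + n) * + n + t * + n       ≡⟨ rearrange (+ (a % + n)) (a / + n) t (+ n) ⟩
      + (a % + n) + (a / + n + t) * + n             ∎
      where
      open ≡-Reasoning
      rearrange : ∀ r q t n → r + q * n + t * n ≡ r + (q + t) * n
      rearrange = solve-∀

  /-+-* : (a + t * + n) / + n ≡ a / + n + t
  /-+-* = proj₁ (div-mod-unique {q = a / + n + t} (n%d<d a (+ n)) a+tn≡)

  %-+-* : (a + t * + n) % + n ≡ a % + n
  %-+-* = proj₂ (div-mod-unique {q = a / + n + t} (n%d<d a (+ n)) a+tn≡)

private
  +-suc-shift : ∀ lo n → lo + + suc n ≡ lo + + 1 + + n
  +-suc-shift lo n = sym (trans (+-assoc lo (+ 1) (+ n)) (cong (λ i → lo + i) (sym (pos-+ 1 n))))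

  i<i+1 : ∀ i → i < i + + 1
  i<i+1 i = ≤-<-trans (≤-reflexive (sym (+-identityʳ i))) (+-monoʳ-< i (+<+ (ℕ.s≤s ℕ.z≤n)))

  <⇒+1≤ : ∀ {i j} → i < j → i + + 1 ≤ j
  <⇒+1≤ {i} i<j = ≤-trans (≤-reflexive (+-comm i (+ 1))) (i<j⇒suc[i]≤j i<j)

  +1≤⇒< : ∀ {i j} → i + + 1 ≤ j → i < j
  +1≤⇒< {i} i+1≤j = <-≤-trans (i<i+1 i) i+1≤j

≤-induction : ∀ (Q : ℤ → Set) {lo} → Q lo → (∀ {i} → lo ≤ i → Q i → Q (i + + 1)) → ∀ {i} → lo ≤ i → Q i
≤-induction Q {lo} base step {i} lo≤i = subst Q lo+∣i-lo∣≡i (from-lo ∣ i - lo ∣)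
  where
  from-lo : ∀ n → Q (lo + + n)
  from-lo zero    = subst Q (sym (+-identityʳ lo)) base
  from-lo (suc n) = subst Q (trans (+-assoc lo (+ n) (+ 1)) (cong (λ j → lo + + j) (ℕ.+-comm n 1)))
                            (step (i≤i+j lo (+ n)) (from-lo n))
  lo+∣i-lo∣≡i : lo + + ∣ i - lo ∣ ≡ i
  lo+∣i-lo∣≡i = trans (cong (λ j → lo + j) (0≤i⇒+∣i∣≡i (i≤j⇒0≤j-i lo≤i))) (cancel lo i)
    where
    cancel : ∀ a b → a + (b - a) ≡ b
    cancel = solve-∀

T-not : ∀ {b} → T (not b) ⇔ (¬ T b)
T-not {false} = mk⇔ (λ _ ()) _
T-not {true}  = mk⇔ (λ ()) (λ ¬t → ¬t _)

T-≤ᵇ : ∀ {a b} → T (a ≤ᵇ b) ⇔ a ≤ b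
T-≤ᵇ = mk⇔ ≤ᵇ⇒≤ ≤⇒≤ᵇ

T-<ᵇ : ∀ {a b} → T (a <ᵇ b) ⇔ a < b
T-<ᵇ = mk⇔ (+1≤⇒< ∘ ≤ᵇ⇒≤) (≤⇒≤ᵇ ∘ <⇒+1≤)

T-== : ∀ {a b} → T (a == b) ⇔ a ≡ b
T-== {a} = mk⇔ (λ h → let a≤b , b≤a = to T-∧ h in ≤-antisym (≤ᵇ⇒≤ a≤b) (≤ᵇ⇒≤ b≤a))
               (λ { refl → from (T-∧ {a ≤ᵇ a}) (≤⇒≤ᵇ (≤-refl {a}) , ≤⇒≤ᵇ (≤-refl {a})) })

infix 4 _<ᴰ_ _≤ᴰ_

_<ᴹᴰ_ : ℤ × ℤ → ℤ × ℤ → Set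
_<ᴹᴰ_ = ×-Lex _≡_ _<_ _<_

_<ᴰ_ : Date → Date → Set
_<ᴰ_ = ×-Lex _≡_ _<_ _<ᴹᴰ_

_≤ᴰ_ : Date → Date → Set
x ≤ᴰ y = ¬ (y <ᴰ x)

T-<ₗ : ∀ {x y} → T (x <ₗ y) ⇔ x <ᴰ y
T-<ₗ = (T-<ᵇ ⊎-⇔ ((T-== ×-⇔ ((T-<ᵇ ⊎-⇔ ((T-== ×-⇔ T-<ᵇ) ⇔-∘ T-∧)) ⇔-∘ T-∨)) ⇔-∘ T-∧)) ⇔-∘ T-∨

T-≤ₗ : ∀ {x y} → T (x ≤ₗ y) ⇔ x ≤ᴰ y
T-≤ₗ = mk⇔ (λ h → to T-not h ∘ from T-<ₗ) (λ h → from T-not (h ∘ to T-<ₗ))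

<ᴰ-trans : ∀ {x y z} → x <ᴰ y → y <ᴰ z → x <ᴰ z
<ᴰ-trans = ×-transitive {_<₂_ = _<ᴹᴰ_} isEquivalence (resp₂ _<_) <-trans
             (×-transitive {_<₂_ = _<_} isEquivalence (resp₂ _<_) <-trans <-trans)

<ᴰ-irrefl : ∀ {x} → ¬ x <ᴰ x
<ᴰ-irrefl (inj₁ a<a) = <-irrefl refl a<a
<ᴰ-irrefl (inj₂ (_ , inj₁ m<m)) = <-irrefl refl m<m
<ᴰ-irrefl (inj₂ (_ , inj₂ (_ , d<d))) = <-irrefl refl d<d

<ᴰ-cmp : ∀ x y → Tri (x <ᴰ y) (x ≡ y) (y <ᴰ x)
<ᴰ-cmp x y with ×-compare {_<₂_ = _<ᴹᴰ_} sym <-cmp (×-compare {_<₂_ = _<_} sym <-cmp <-cmp) x y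
... | tri< x<y _ _ = tri< x<y (λ { refl → <ᴰ-irrefl x<y }) (λ y<x → <ᴰ-irrefl (<ᴰ-trans x<y y<x))
... | tri≈ _ (refl , refl , refl) _ = tri≈ <ᴰ-irrefl refl <ᴰ-irrefl
... | tri> _ _ y<x = tri> (λ x<y → <ᴰ-irrefl (<ᴰ-trans x<y y<x)) (λ { refl → <ᴰ-irrefl y<x }) y<x

<⇒≤ᴰ : ∀ {x y} → x <ᴰ y → x ≤ᴰ y
<⇒≤ᴰ x<y y<x = <ᴰ-irrefl (<ᴰ-trans x<y y<x)

<-≤ᴰ-trans : ∀ {x y z} → x <ᴰ y → y ≤ᴰ z → x <ᴰ z
<-≤ᴰ-trans {x} {z = z} x<y y≤z with <ᴰ-cmp x z
... | tri< x<z _ _ = x<z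
... | tri≈ _ refl _ = contradiction x<y y≤z
... | tri> _ _ z<x = contradiction (<ᴰ-trans z<x x<y) y≤z

≤-<ᴰ-trans : ∀ {x y z} → x ≤ᴰ y → y <ᴰ z → x <ᴰ z
≤-<ᴰ-trans {x} {z = z} x≤y y<z with <ᴰ-cmp x z
... | tri< x<z _ _ = x<z
... | tri≈ _ refl _ = contradiction y<z x≤y
... | tri> _ _ z<x = contradiction (<ᴰ-trans y<z z<x) x≤y

≤ᴰ-trans : ∀ {x y z} → x ≤ᴰ y → y ≤ᴰ z → x ≤ᴰ z
≤ᴰ-trans x≤y y≤z z<x = y≤z (<-≤ᴰ-trans z<x x≤y)

<ᴰ-dichotomy : ∀ x y → x <ᴰ y ⊎ y ≤ᴰ x
<ᴰ-dichotomy x y with <ᴰ-cmp x y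
... | tri< x<y _ _ = inj₁ x<y
... | tri≈ _ refl _ = inj₂ <ᴰ-irrefl
... | tri> _ _ y<x = inj₂ (<⇒≤ᴰ y<x)

yr-mono-< : ∀ {x y} → x <ᴰ y → yr x ≤ yr y
yr-mono-< (inj₁ a<a') = <⇒≤ a<a'
yr-mono-< (inj₂ (refl , _)) = ≤-refl

yr-mono-≤ : ∀ {x y} → x ≤ᴰ y → yr x ≤ yr y
yr-mono-≤ x≤y = ≮⇒≥ (x≤y ∘ inj₁)

T-inGᵇ : ∀ y m d → T (inGᵇ (y , m , d)) ⇔ (+ 1 ≤ m × m ≤ + 12 × + 1 ≤ d × d ≤ monthLength y m)
T-inGᵇ y m d = (T-≤ᵇ ×-⇔ ((T-≤ᵇ ×-⇔ ((T-≤ᵇ ×-⇔ T-≤ᵇ) ⇔-∘ T-∧)) ⇔-∘ T-∧)) ⇔-∘ T-∧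

monthLength-≤-31 : ∀ y m → monthLength y m ≤ + 31
monthLength-≤-31 y m with m == + 2 | isLeap y | (m == + 4) ∨ (m == + 6) ∨ (m == + 9) ∨ (m == + 11)
... | true  | true  | _     = ≤ᵇ⇒≤ _
... | true  | false | _     = ≤ᵇ⇒≤ _
... | false | _     | true  = ≤ᵇ⇒≤ _
... | false | _     | false = ≤ᵇ⇒≤ _

1≤monthLength : ∀ y m → + 1 ≤ monthLength y m
1≤monthLength y m with m == + 2 | isLeap y | (m == + 4) ∨ (m == + 6) ∨ (m == + 9) ∨ (m == + 11)
... | true  | true  | _     = ≤ᵇ⇒≤ _
... | true  | false | _     = ≤ᵇ⇒≤ _
... | false | _     | true  = ≤ᵇ⇒≤ _
... | false | _     | false = ≤ᵇ⇒≤ _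

T-inGgeᵇ : ∀ e x → T (inGgeᵇ e x) ⇔ (InG x × e ≤ᴰ x)
T-inGgeᵇ e x = (⇔-id (InG x) ×-⇔ T-≤ₗ) ⇔-∘ T-∧

-- Counting

private variable
  A B : Set

count : (A → Bool) → List A → ℕ
count p xs = length (filterᵇ p xs)

count-++ : ∀ (p : A → Bool) xs ys → count p (xs ++ ys) ≡ count p xs ℕ.+ count p ys
count-++ p xs ys =
  trans (cong length (filter-++ (T? ∘ p) xs ys)) (length-++ (filterᵇ p xs) {filterᵇ p ys})

count-concatMap : ∀ p (f : B → List A) xs →
                  count p (concatMap f xs) ≡ sum (map (count p ∘ f) xs)
count-concatMap p f []       = refl
count-concatMap p f (x ∷ xs) =
  trans (count-++ p (f x) (concatMap f xs)) (cong (count p (f x) ℕ.+_) (count-concatMap p f xs))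

count-map : ∀ (p : A → Bool) (f : B → A) xs → count p (map f xs) ≡ count (p ∘ f) xs
count-map p f []       = refl
count-map p f (x ∷ xs) with p (f x)
... | true  = cong suc (count-map p f xs)
... | false = count-map p f xs

count-singletons : ∀ (p : A → Bool) xs → count p xs ≡ sum (map (λ x → count p (x ∷ [])) xs)
count-singletons p []       = refl
count-singletons p (x ∷ xs) =
  trans (count-++ p (x ∷ []) xs) (cong (count p (x ∷ []) ℕ.+_) (count-singletons p xs))

count-none : ∀ (p : A → Bool) xs → (∀ x → ¬ T (p x)) → count p xs ≡ 0
count-none p xs none = cong length (filter-none (T? ∘ p) (All.universal none xs))

count-disjoint-∨ : ∀ (p : A → Bool) q xs → (∀ x → T (p x) → ¬ T (q x)) →
                   count (λ x → p x ∨ q x) xs ≡ count p xs ℕ.+ count q xs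
count-disjoint-∨ p q []       _        = refl
count-disjoint-∨ p q (x ∷ xs) disjoint with p x | q x | disjoint x
... | true  | true  | d = contradiction _ (d _)
... | true  | false | _ = cong suc (count-disjoint-∨ p q xs disjoint)
... | false | true  | _ = trans (cong suc (count-disjoint-∨ p q xs disjoint)) (sym (ℕ.+-suc _ _))
... | false | false | _ = count-disjoint-∨ p q xs disjoint

count-cong : ∀ (p q : A → Bool) xs → (∀ x → T (p x) ⇔ T (q x)) → count p xs ≡ count q xs
count-cong p q xs p⇔q =
  cong length (filter-≐ (T? ∘ p) (T? ∘ q) (to (p⇔q _) , from (p⇔q _)) xs)

rangeSum : ℤ → ℕ → (ℤ → ℕ) → ℕ
rangeSum lo n f = sum (map f (intRange lo n))

rangeSum-vanishing : ∀ {f} lo n → (∀ y → lo ≤ y → f y ≡ 0) → rangeSum lo n f ≡ 0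
rangeSum-vanishing lo zero    _    = refl
rangeSum-vanishing lo (suc n) vanish = cong₂ ℕ._+_ (vanish lo ≤-refl)
  (rangeSum-vanishing (lo + + 1) n (λ y lo+1≤y → vanish y (≤-trans (<⇒≤ (i<i+1 lo)) lo+1≤y)))

rangeSum-cover : ∀ {f t} lo n k → (∀ y → t < y → f y ≡ 0) →
                 t < lo + + n → t < lo + + k → rangeSum lo n f ≡ rangeSum lo k f
rangeSum-cover lo zero k above t<lo _ =
  sym (rangeSum-vanishing lo k (λ y lo≤y → above y (<-≤-trans (subst (_ <_) (+-identityʳ lo) t<lo) lo≤y)))
rangeSum-cover lo (suc n) zero above _ t<lo =
  rangeSum-vanishing lo (suc n) (λ y lo≤y → above y (<-≤-trans (subst (_ <_) (+-identityʳ lo) t<lo) lo≤y))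
rangeSum-cover {f} lo (suc n) (suc k) above t<lo+n t<lo+k = cong (f lo ℕ.+_)
  (rangeSum-cover (lo + + 1) n k above (subst (_ <_) (+-suc-shift lo n) t<lo+n)
                                       (subst (_ <_) (+-suc-shift lo k) t<lo+k))

rangeSum-support : ∀ {f s t} lo n k → (∀ y → y < s → f y ≡ 0) → (∀ y → t < y → f y ≡ 0) →
                   lo ≤ s → t < lo + + n → t < s + + k → rangeSum lo n f ≡ rangeSum s k f
rangeSum-support {f} {s} lo n k below above lo≤s t<lo+n t<s+k with <-cmp lo s
... | tri≈ _ refl _ = rangeSum-cover lo n k above t<lo+n t<s+k
... | tri> _ _ s<lo = contradiction lo≤s (<⇒≱ s<lo)
... | tri< lo<s _ _ with n
...   | zero  = sym (rangeSum-vanishing s k λ y s≤y →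
                    above y (<-≤-trans (subst (_ <_) (+-identityʳ lo) t<lo+n) (≤-trans (<⇒≤ lo<s) s≤y)))
...   | suc n = cong₂ ℕ._+_ (below lo lo<s)
                  (rangeSum-support (lo + + 1) n k below above (<⇒+1≤ lo<s)
                                    (subst (_ <_) (+-suc-shift lo n) t<lo+n) t<s+k)

rangeSum-point : ∀ {f c} lo n → (∀ y → y ≢ c → f y ≡ 0) → lo ≤ c → c < lo + + n → rangeSum lo n f ≡ f c
rangeSum-point {f} {c} lo n elsewhere lo≤c c<lo+n =
  trans (rangeSum-support lo n 1 (λ y y<c → elsewhere y (<⇒≢ y<c)) (λ y c<y → elsewhere y (≢-sym (<⇒≢ c<y)))
                          lo≤c c<lo+n (i<i+1 c))
        (ℕ.+-identityʳ (f c))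

datesOfYear : ℤ → List Date
datesOfYear y = concatMap (λ m → map (λ d → (y , m , d)) (intRange (+ 1) 31)) (intRange (+ 1) 12)

count-candidates : ∀ p lo hi →
  count p (candidates lo hi) ≡ rangeSum lo (suc ∣ hi - lo ∣) (λ y → count p (datesOfYear y))
count-candidates p lo hi = count-concatMap p datesOfYear (intRange lo (suc ∣ hi - lo ∣))

count-datesOfYear : ∀ p y →
  count p (datesOfYear y) ≡ rangeSum (+ 1) 12 (λ m → count (λ d → p (y , m , d)) (intRange (+ 1) 31))
count-datesOfYear p y =
  trans (count-concatMap p (λ m → map (λ d → (y , m , d)) (intRange (+ 1) 31)) (intRange (+ 1) 12))
        (cong sum (map-cong (λ m → count-map p (λ d → (y , m , d)) (intRange (+ 1) 31)) (intRange (+ 1) 12)))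

count-datesOfYear-none : ∀ p y → (∀ m d → ¬ T (p (y , m , d))) → count p (datesOfYear y) ≡ 0
count-datesOfYear-none p y none = trans (count-datesOfYear p y)
  (rangeSum-vanishing (+ 1) 12 (λ m _ → count-none _ (intRange (+ 1) 31) (none m)))

hi<lo+range : ∀ {lo hi} → lo ≤ hi → hi < lo + + suc ∣ hi - lo ∣
hi<lo+range {lo} {hi} lo≤hi = subst (hi <_) (sym lo+range≡) (i<i+1 hi)
  where
  lo+range≡ : lo + + suc ∣ hi - lo ∣ ≡ hi + + 1
  lo+range≡ = begin
    lo + + suc ∣ hi - lo ∣      ≡⟨ cong (λ i → lo + (+ 1 + i)) (0≤i⇒+∣i∣≡i (i≤j⇒0≤j-i lo≤hi)) ⟩
    lo + (+ 1 + (hi - lo))      ≡⟨ solve (lo ∷ hi ∷ []) ⟩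
    hi + + 1                    ∎
    where open ≡-Reasoning

count-candidates-restrict : ∀ p lo hi s t → (∀ z → T (p z) → s ≤ yr z × yr z ≤ t) →
  lo ≤ s → s ≤ t → t ≤ hi → count p (candidates lo hi) ≡ count p (candidates s t)
count-candidates-restrict p lo hi s t support lo≤s s≤t t≤hi = begin
  count p (candidates lo hi)                                        ≡⟨ count-candidates p lo hi ⟩
  rangeSum lo (suc ∣ hi - lo ∣) (λ y → count p (datesOfYear y))
    ≡⟨ rangeSum-support lo _ _ below above lo≤s
         (≤-<-trans t≤hi (hi<lo+range (≤-trans lo≤s (≤-trans s≤t t≤hi)))) (hi<lo+range s≤t) ⟩
  rangeSum s (suc ∣ t - s ∣) (λ y → count p (datesOfYear y))        ≡⟨ count-candidates p s t ⟨
  count p (candidates s t)                                          ∎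
  where
  open ≡-Reasoning
  below : ∀ y → y < s → count p (datesOfYear y) ≡ 0
  below y y<s = count-datesOfYear-none p y (λ m d pz → <⇒≱ y<s (proj₁ (support _ pz)))
  above : ∀ y → t < y → count p (datesOfYear y) ≡ 0
  above y t<y = count-datesOfYear-none p y (λ m d pz → <⇒≱ t<y (proj₂ (support _ pz)))

count-singleton-accept : ∀ (p : A → Bool) {x} → T (p x) → count p (x ∷ []) ≡ 1
count-singleton-accept p {x} px with p x
... | true = refl

count-singleton-reject : ∀ (p : A → Bool) {x} → ¬ T (p x) → count p (x ∷ []) ≡ 0
count-singleton-reject p {x} ¬px with p x
... | true  = contradiction _ ¬px
... | false = refl

count-candidates-point : ∀ p lo hi {y m d} → T (p (y , m , d)) → (∀ z → T (p z) → z ≡ (y , m , d)) →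
  lo ≤ y → y ≤ hi → + 1 ≤ m → m ≤ + 12 → + 1 ≤ d → d ≤ + 31 → count p (candidates lo hi) ≡ 1
count-candidates-point p lo hi {y} {m} {d} px unique lo≤y y≤hi 1≤m m≤12 1≤d d≤31 = begin
  count p (candidates lo hi)
    ≡⟨ count-candidates p lo hi ⟩
  rangeSum lo (suc ∣ hi - lo ∣) (λ y → count p (datesOfYear y))
    ≡⟨ rangeSum-point lo _ otherYear lo≤y (≤-<-trans y≤hi (hi<lo+range (≤-trans lo≤y y≤hi))) ⟩
  count p (datesOfYear y)
    ≡⟨ count-datesOfYear p y ⟩
  rangeSum (+ 1) 12 (λ m → count (λ d → p (y , m , d)) (intRange (+ 1) 31))
    ≡⟨ rangeSum-point (+ 1) 12 otherMonth 1≤m (≤-<-trans m≤12 (i<i+1 (+ 12))) ⟩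
  count (λ d → p (y , m , d)) (intRange (+ 1) 31)
    ≡⟨ count-singletons (λ d → p (y , m , d)) (intRange (+ 1) 31) ⟩
  rangeSum (+ 1) 31 (λ d → count (λ d → p (y , m , d)) (d ∷ []))
    ≡⟨ rangeSum-point (+ 1) 31 otherDay 1≤d (≤-<-trans d≤31 (i<i+1 (+ 31))) ⟩
  count (λ d → p (y , m , d)) (d ∷ [])
    ≡⟨ count-singleton-accept (λ d → p (y , m , d)) px ⟩
  1 ∎
  where
  open ≡-Reasoning
  otherYear : ∀ y' → y' ≢ y → count p (datesOfYear y') ≡ 0
  otherYear y' y'≢y = count-datesOfYear-none p y' (λ m' d' pz → y'≢y (cong yr (unique _ pz)))
  otherMonth : ∀ m' → m' ≢ m → count (λ d → p (y , m' , d)) (intRange (+ 1) 31) ≡ 0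
  otherMonth m' m'≢m = count-none (λ d → p (y , m' , d)) (intRange (+ 1) 31)
                                  (λ d' pz → m'≢m (cong (proj₁ ∘ proj₂) (unique _ pz)))
  otherDay : ∀ d' → d' ≢ d → count (λ d → p (y , m , d)) (d' ∷ []) ≡ 0
  otherDay d' d'≢d = count-singleton-reject (λ d → p (y , m , d))
                                            (λ pz → d'≢d (cong (proj₂ ∘ proj₂) (unique _ pz)))

-- Rata die

pos-difference : ∀ {m n k} → m ℕ.+ n ≡ k → + n ≡ + k - + m
pos-difference {m} {n} refl = trans (cancel (+ m) (+ n)) (cong (_- + m) (sym (pos-+ m n)))
  where
  cancel : ∀ a b → b ≡ a + b - a
  cancel = solve-∀

neg-difference : ∀ {m n k} → m ℕ.+ n ≡ k → - + n ≡ + m - + k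
neg-difference {m} {n} refl = trans (cancel (+ m) (+ n)) (cong (λ i → + m - i) (sym (pos-+ m n)))
  where
  cancel : ∀ a b → - b ≡ a - (a + b)
  cancel = solve-∀

intervalᵇ : (Date → Bool) → Date → Date → Date → Bool
intervalᵇ C a b z = C z ∧ (a ≤ₗ z) ∧ (z <ₗ b)

T-intervalᵇ : ∀ C a b z → T (intervalᵇ C a b z) ⇔ (T (C z) × a ≤ᴰ z × z <ᴰ b)
T-intervalᵇ C a b z = (⇔-id (T (C _)) ×-⇔ ((T-≤ₗ ×-⇔ T-<ₗ) ⇔-∘ T-∧)) ⇔-∘ T-∧

module _ (C : Date → Bool) where

  countInterval-canonical : ∀ a b lo hi → a ≤ᴰ b → lo ≤ yr a → yr b ≤ hi →
    countInterval C a b ≡ count (intervalᵇ C a b) (candidates lo hi)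
  countInterval-canonical a b lo hi a≤b lo≤a b≤hi = begin
    countInterval C a b
      ≡⟨ cong₂ (λ lo hi → count (intervalᵇ C a b) (candidates lo hi)) {yr a ⊓ yr b} {yr a} {yr a ⊔ yr b} {yr b}
               (i≤j⇒i⊓j≡i ya≤yb) (i≤j⇒i⊔j≡j ya≤yb) ⟩
    count (intervalᵇ C a b) (candidates (yr a) (yr b))
      ≡⟨ count-candidates-restrict (intervalᵇ C a b) lo hi (yr a) (yr b) support lo≤a ya≤yb b≤hi ⟨
    count (intervalᵇ C a b) (candidates lo hi) ∎
    where
    open ≡-Reasoning
    ya≤yb = yr-mono-≤ a≤b
    support : ∀ z → T (intervalᵇ C a b z) → yr a ≤ yr z × yr z ≤ yr b
    support z h = let _ , a≤z , z<b = to (T-intervalᵇ C a b z) h in yr-mono-≤ a≤z , yr-mono-< z<b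

  countInterval-additive : ∀ {a b c} → a ≤ᴰ b → b ≤ᴰ c →
    countInterval C a b ℕ.+ countInterval C b c ≡ countInterval C a c
  countInterval-additive {a} {b} {c} a≤b b≤c = begin
    countInterval C a b ℕ.+ countInterval C b c
      ≡⟨ cong₂ ℕ._+_ (countInterval-canonical a b (yr a) (yr c) a≤b ≤-refl (yr-mono-≤ b≤c))
                     (countInterval-canonical b c (yr a) (yr c) b≤c (yr-mono-≤ a≤b) ≤-refl) ⟩
    count (intervalᵇ C a b) cands ℕ.+ count (intervalᵇ C b c) cands
      ≡⟨ count-disjoint-∨ (intervalᵇ C a b) (intervalᵇ C b c) cands disjoint ⟨
    count (λ z → intervalᵇ C a b z ∨ intervalᵇ C b c z) cands
      ≡⟨ count-cong _ (intervalᵇ C a c) cands (λ _ → split ⇔-∘ T-∨) ⟩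
    count (intervalᵇ C a c) cands
      ≡⟨ countInterval-canonical a c (yr a) (yr c) a≤c ≤-refl ≤-refl ⟨
    countInterval C a c ∎
    where
    open ≡-Reasoning
    cands = candidates (yr a) (yr c)
    a≤c = ≤ᴰ-trans a≤b b≤c
    disjoint : ∀ z → T (intervalᵇ C a b z) → ¬ T (intervalᵇ C b c z)
    disjoint z in-ab in-bc =
      proj₁ (proj₂ (to (T-intervalᵇ C b c z) in-bc)) (proj₂ (proj₂ (to (T-intervalᵇ C a b z) in-ab)))
    split : ∀ {z} → (T (intervalᵇ C a b z) ⊎ T (intervalᵇ C b c z)) ⇔ T (intervalᵇ C a c z)
    split {z} = mk⇔ (from ac ∘ widen ∘ Sum.map (to ab) (to bc)) (Sum.map (from ab) (from bc) ∘ cut ∘ to ac)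
      where
      ab = T-intervalᵇ C a b z
      bc = T-intervalᵇ C b c z
      ac = T-intervalᵇ C a c z
      widen : (T (C z) × a ≤ᴰ z × z <ᴰ b) ⊎ (T (C z) × b ≤ᴰ z × z <ᴰ c) → T (C z) × a ≤ᴰ z × z <ᴰ c
      widen (inj₁ (Cz , a≤z , z<b)) = Cz , a≤z , <-≤ᴰ-trans z<b b≤c
      widen (inj₂ (Cz , b≤z , z<c)) = Cz , ≤ᴰ-trans a≤b b≤z , z<c
      cut : T (C z) × a ≤ᴰ z × z <ᴰ c → (T (C z) × a ≤ᴰ z × z <ᴰ b) ⊎ (T (C z) × b ≤ᴰ z × z <ᴰ c)
      cut (Cz , a≤z , z<c) with <ᴰ-cmp z b
      ... | tri< z<b _ _ = inj₁ (Cz , a≤z , z<b)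
      ... | tri≈ _ refl _ = inj₂ (Cz , <ᴰ-irrefl , z<c)
      ... | tri> _ _ b<z = inj₂ (Cz , <⇒≤ᴰ b<z , z<c)

  countInterval-self : ∀ a → countInterval C a a ≡ 0
  countInterval-self a = count-none (intervalᵇ C a a) (candidates (yr a ⊓ yr a) (yr a ⊔ yr a)) λ z h →
    let _ , a≤z , z<a = to (T-intervalᵇ C a a z) h in a≤z z<a

  countInterval-point : ∀ {y m d x'} → T (C (y , m , d)) → InG (y , m , d) → (y , m , d) <ᴰ x' →
    (∀ z → T (C z) → (y , m , d) ≤ᴰ z → z <ᴰ x' → z ≡ (y , m , d)) → countInterval C (y , m , d) x' ≡ 1
  countInterval-point {y} {m} {d} {x'} Cx x∈G x<x' unique =
    let 1≤m , m≤12 , 1≤d , d≤L = to (T-inGᵇ y m d) x∈G in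
    count-candidates-point (intervalᵇ C x x') (y ⊓ yr x') (y ⊔ yr x')
      (from (T-intervalᵇ C x x' x) (Cx , <ᴰ-irrefl , x<x'))
      (λ z h → let Cz , x≤z , z<x' = to (T-intervalᵇ C x x' z) h in unique z Cz x≤z z<x')
      (i⊓j≤i y (yr x')) (i≤i⊔j y (yr x')) 1≤m m≤12 1≤d (≤-trans d≤L (monthLength-≤-31 y m))
    where
    x = (y , m , d)

  rataDie-≤ : ∀ {e x} → e ≤ᴰ x → rataDie C e x ≡ + countInterval C e x
  rataDie-≤ {e} {x} e≤x = cong (λ b → if b then + countInterval C e x else - + countInterval C x e)
                              (to T-≡ (from T-≤ₗ e≤x))

  rataDie-> : ∀ {e x} → x <ᴰ e → rataDie C e x ≡ - + countInterval C x e
  rataDie-> {e} {x} x<e = cong (λ b → if not b then + countInterval C e x else - + countInterval C x e)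
                              (to T-≡ (from T-<ₗ x<e))

  rataDie-rebase : ∀ {e e' x} → e ≤ᴰ e' → e ≤ᴰ x → rataDie C e' x ≡ rataDie C e x - rataDie C e e'
  rataDie-rebase {e} {e'} {x} e≤e' e≤x with <ᴰ-dichotomy x e'
  ... | inj₁ x<e' = begin
    rataDie C e' x                                 ≡⟨ rataDie-> x<e' ⟩
    - + countInterval C x e'                       ≡⟨ neg-difference (countInterval-additive e≤x (<⇒≤ᴰ x<e')) ⟩
    + countInterval C e x - + countInterval C e e' ≡⟨ cong₂ _-_ (rataDie-≤ e≤x) (rataDie-≤ e≤e') ⟨
    rataDie C e x - rataDie C e e'                 ∎
    where open ≡-Reasoning
  ... | inj₂ e'≤x = begin
    rataDie C e' x                                 ≡⟨ rataDie-≤ e'≤x ⟩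
    + countInterval C e' x                         ≡⟨ pos-difference (countInterval-additive e≤e' e'≤x) ⟩
    + countInterval C e x - + countInterval C e e' ≡⟨ cong₂ _-_ (rataDie-≤ e≤x) (rataDie-≤ e≤e') ⟨
    rataDie C e x - rataDie C e e'                 ∎
    where open ≡-Reasoning

-- The day after

data NextDay : Date → Date → Set where
  sameMonth : ∀ {y m d} → d < monthLength y m → NextDay (y , m , d) (y , m , d + + 1)
  nextMonth : ∀ {y m} → m < + 12 → NextDay (y , m , monthLength y m) (y , m + + 1 , + 1)
  nextYear  : ∀ {y} → NextDay (y , + 12 , + 31) (y + + 1 , + 1 , + 1)

private
  nothing-between : ∀ {i j} → i < j → j < i + + 1 → ⊥
  nothing-between i<j j<i+1 = <⇒≱ j<i+1 (<⇒+1≤ i<j)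

nextDay-< : ∀ {x x'} → NextDay x x' → x <ᴰ x'
nextDay-< (sameMonth _) = inj₂ (refl , inj₂ (refl , i<i+1 _))
nextDay-< (nextMonth _) = inj₂ (refl , inj₁ (i<i+1 _))
nextDay-< nextYear      = inj₁ (i<i+1 _)

nextDay-∈G : ∀ {x x'} → NextDay x x' → InG x → InG x'
nextDay-∈G {y , m , d} (sameMonth d<L) x∈G =
  let 1≤m , m≤12 , 1≤d , _ = to (T-inGᵇ y m d) x∈G
  in from (T-inGᵇ y m (d + + 1))
       (1≤m , m≤12 , ≤-trans 1≤d (<⇒≤ (i<i+1 d)) , <⇒+1≤ d<L)
nextDay-∈G {y , m , _} (nextMonth m<12) x∈G =
  let 1≤m , _ = to (T-inGᵇ y m (monthLength y m)) x∈G
  in from (T-inGᵇ y (m + + 1) (+ 1))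
       (≤-trans 1≤m (<⇒≤ (i<i+1 m)) , <⇒+1≤ m<12 , ≤-refl , 1≤monthLength y (m + + 1))
nextDay-∈G nextYear _ = _

private
  lex-squeeze : ∀ {B : Set} {R : B → B → Set} {a b u v w} →
                ×-Lex _≡_ _<_ R (a , u) (b , v) → ×-Lex _≡_ _<_ R (b , v) (a , w) → a ≡ b × R u v × R v w
  lex-squeeze (inj₁ a<b)        (inj₁ b<a)        = contradiction b<a (<-asym a<b)
  lex-squeeze (inj₁ a<b)        (inj₂ (refl , _)) = contradiction a<b (<-irrefl refl)
  lex-squeeze (inj₂ (refl , _)) (inj₁ a<a)        = contradiction a<a (<-irrefl refl)
  lex-squeeze (inj₂ (refl , u<v)) (inj₂ (_ , v<w)) = refl , u<v , v<w

nextDay-covers : ∀ {x x' z} → NextDay x x' → InG z → x <ᴰ z → ¬ z <ᴰ x'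
nextDay-covers {y , m , d} {z = a , b , c} (sameMonth _) _ x<z z<x' with lex-squeeze {R = _<ᴹᴰ_} x<z z<x'
... | refl , md<bc , bc<md' with lex-squeeze {R = _<_} md<bc bc<md'
...   | refl , d<c , c<d+1 = nothing-between d<c c<d+1
nextDay-covers {y , m , _} {z = a , b , c} (nextMonth _) z∈G x<z z<x' with lex-squeeze {R = _<ᴹᴰ_} x<z z<x'
... | refl , inj₁ m<b , inj₁ b<m+1 = nothing-between m<b b<m+1
... | refl , inj₁ _ , inj₂ (_ , c<1) = <⇒≱ c<1 (proj₁ (proj₂ (proj₂ (to (T-inGᵇ a b c) z∈G))))
... | refl , inj₂ (refl , L<c) , _ = <⇒≱ L<c (proj₂ (proj₂ (proj₂ (to (T-inGᵇ a b c) z∈G))))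
nextDay-covers {y , _ , _} {z = a , b , c} nextYear z∈G x<z z<x' with to (T-inGᵇ a b c) z∈G
... | 1≤b , b≤12 , 1≤c , c≤L with x<z | z<x'
...   | inj₁ y<a | inj₁ a<y+1 = nothing-between y<a a<y+1
...   | inj₁ _   | inj₂ (_ , inj₁ b<1) = <⇒≱ b<1 1≤b
...   | inj₁ _   | inj₂ (_ , inj₂ (_ , c<1)) = <⇒≱ c<1 1≤c
...   | inj₂ (refl , inj₁ 12<b) | _ = <⇒≱ 12<b b≤12
...   | inj₂ (refl , inj₂ (refl , 31<c)) | _ = <⇒≱ 31<c (≤-trans c≤L (monthLength-≤-31 a b))

nextDay-∈G₂ : ∀ {e x x'} → NextDay x x' → T (inGgeᵇ e x) → T (inGgeᵇ e x')
nextDay-∈G₂ {e} {x} {x'} next x∈G₂ = let x∈G , e≤x = to (T-inGgeᵇ e x) x∈G₂ in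
  from (T-inGgeᵇ e x') (nextDay-∈G next x∈G , <⇒≤ᴰ (≤-<ᴰ-trans e≤x (nextDay-< next)))

countInterval-nextDay : ∀ {e x x'} → NextDay x x' → T (inGgeᵇ e x) →
  countInterval (inGgeᵇ e) e x' ≡ suc (countInterval (inGgeᵇ e) e x)
countInterval-nextDay {e} {x@(_ , _ , _)} {x'} next x∈G₂ = begin
  countInterval C e x'
    ≡⟨ countInterval-additive C e≤x (<⇒≤ᴰ x<x') ⟨
  countInterval C e x ℕ.+ countInterval C x x'
    ≡⟨ cong (countInterval C e x ℕ.+_) (countInterval-point C x∈G₂ x∈G x<x' only-x) ⟩
  countInterval C e x ℕ.+ 1
    ≡⟨ ℕ.+-comm _ 1 ⟩
  suc (countInterval C e x) ∎
  where
  open ≡-Reasoning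
  C = inGgeᵇ e
  x∈G = proj₁ (to (T-inGgeᵇ e x) x∈G₂)
  e≤x = proj₂ (to (T-inGgeᵇ e x) x∈G₂)
  x<x' = nextDay-< next
  only-x : ∀ z → T (C z) → x ≤ᴰ z → z <ᴰ x' → z ≡ x
  only-x z z∈G₂ x≤z z<x' with <ᴰ-cmp x z
  ... | tri< x<z _ _ = contradiction z<x' (nextDay-covers next (proj₁ (to (T-inGgeᵇ e z) z∈G₂)) x<z)
  ... | tri≈ _ x≡z _ = sym x≡z
  ... | tri> _ _ z<x = contradiction z<x x≤z

module _ (z : ℤ) (P : Date → Set) (base : P (z , + 3 , + 1))
         (step : ∀ {x x'} → NextDay x x' → T (inGgeᵇ (z , + 3 , + 1) x) → P x → P x') where

  private
    e : Date
    e = (z , + 3 , + 1)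

    Reach : Date → Set
    Reach x = T (inGgeᵇ e x) × P x

    advance : ∀ {x x'} → NextDay x x' → Reach x → Reach x'
    advance next (x∈G₂ , Px) = nextDay-∈G₂ next x∈G₂ , step next x∈G₂ Px

    days : ∀ {y m d} → Reach (y , m , + 1) → + 1 ≤ d → d ≤ monthLength y m → Reach (y , m , d)
    days {y} {m} first = ≤-induction (λ d → d ≤ monthLength y m → Reach (y , m , d)) (λ _ → first)
      (λ {d} _ reach d+1≤L → let d<L = +1≤⇒< d+1≤L in advance (sameMonth d<L) (reach (<⇒≤ d<L)))

    months : ∀ {y m m'} → Reach (y , m , + 1) → m ≤ m' → m' ≤ + 12 → Reach (y , m' , + 1)
    months {y} first = ≤-induction (λ m' → m' ≤ + 12 → Reach (y , m' , + 1)) (λ _ → first)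
      (λ {m'} _ reach m'+1≤12 → let m'<12 = +1≤⇒< m'+1≤12 in
         advance (nextMonth m'<12) (days (reach (<⇒≤ m'<12)) (1≤monthLength y m') ≤-refl))

    newYear : ∀ {y} → Reach (y , + 3 , + 1) → Reach (y + + 1 , + 1 , + 1)
    newYear reach = advance nextYear (days (months reach (≤ᵇ⇒≤ _) ≤-refl) (≤ᵇ⇒≤ _) ≤-refl)

    march : ∀ {y} → z ≤ y → Reach (y , + 3 , + 1)
    march = ≤-induction (λ y → Reach (y , + 3 , + 1))
      (from (T-inGgeᵇ e e) (_ , <ᴰ-irrefl) , base)
      (λ _ reach → months (newYear reach) (≤ᵇ⇒≤ _) (≤ᵇ⇒≤ _))

    january : ∀ {y} → z < y → Reach (y , + 1 , + 1)
    january z<y = ≤-induction (λ y → Reach (y , + 1 , + 1)) (newYear (march ≤-refl))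
      (λ _ reach → newYear (months reach (≤ᵇ⇒≤ _) (≤ᵇ⇒≤ _))) (<⇒+1≤ z<y)

  nextDay-induction : ∀ x → T (inGgeᵇ (z , + 3 , + 1) x) → P x
  nextDay-induction (a , b , c) x∈G₂ with to (T-inGgeᵇ e (a , b , c)) x∈G₂
  ... | x∈G , e≤x with to (T-inGᵇ a b c) x∈G
  ...   | 1≤b , b≤12 , 1≤c , c≤L with b <? + 3
  ...     | no b≮3  = proj₂ (days (months (march (yr-mono-≤ e≤x)) (≮⇒≥ b≮3) b≤12) 1≤c c≤L)
  ...     | yes b<3 = proj₂ (days (months (january z<a) 1≤b b≤12) 1≤c c≤L)
    where
    z<a : z < a
    z<a = ≤∧≢⇒< (yr-mono-≤ e≤x) (λ { refl → e≤x (inj₂ (refl , inj₁ b<3)) })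

-- Days before a year

-- The paper's y_c and m_c. Years are counted from 1 March, so year y ends with the leap day
-- of calendar year y + 1.
daysBeforeYear : ℤ → ℤ
daysBeforeYear y = (+ 1461 * y) / + 4 - y / + 100 + (y / + 100) / + 4

daysBeforeMonth : ℤ → ℤ
daysBeforeMonth m = (+ 979 * m - + 2919) / + 32

leapDay : ℤ → ℤ
leapDay y = if isLeap y then + 1 else + 0

isLeap-+400 : ∀ s t → isLeap (s + t * + 400) ≡ isLeap s
isLeap-+400 s t = cong (λ (r₄ , r₁₀₀ , r₄₀₀) → ((r₄ ℕ.≡ᵇ 0) ∧ not (r₁₀₀ ℕ.≡ᵇ 0)) ∨ (r₄₀₀ ℕ.≡ᵇ 0))
                       (cong₂ _,_ mod4 (cong₂ _,_ mod100 (%-+-* s t)))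
  where
  regroup₄ : ∀ s t → s + t * + 400 ≡ s + t * + 100 * + 4
  regroup₄ = solve-∀
  regroup₁₀₀ : ∀ s t → s + t * + 400 ≡ s + t * + 4 * + 100
  regroup₁₀₀ = solve-∀
  mod4 : (s + t * + 400) % + 4 ≡ s % + 4
  mod4 = trans (cong (_% + 4) (regroup₄ s t)) (%-+-* s (t * + 100))
  mod100 : (s + t * + 400) % + 100 ≡ s % + 100
  mod100 = trans (cong (_% + 100) (regroup₁₀₀ s t)) (%-+-* s (t * + 4))

daysBeforeYear-+400 : ∀ s t → daysBeforeYear (s + t * + 400) ≡ daysBeforeYear s + t * + 146097
daysBeforeYear-+400 s t = begin
  (+ 1461 * (s + t * + 400)) / + 4 - (s + t * + 400) / + 100 + ((s + t * + 400) / + 100) / + 4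
    ≡⟨ cong₂ (λ u v → u / + 4 - v / + 100 + (v / + 100) / + 4) (regroup₄ s t) (regroup₁₀₀ s t) ⟩
  (+ 1461 * s + t * + 146100 * + 4) / + 4 - (s + t * + 4 * + 100) / + 100
    + ((s + t * + 4 * + 100) / + 100) / + 4
    ≡⟨ cong₂ (λ u v → u - v + v / + 4) (/-+-* (+ 1461 * s) (t * + 146100)) (/-+-* s (t * + 4)) ⟩
  ((+ 1461 * s) / + 4 + t * + 146100) - (s / + 100 + t * + 4) + (s / + 100 + t * + 4) / + 4
    ≡⟨ cong (λ u → ((+ 1461 * s) / + 4 + t * + 146100) - (s / + 100 + t * + 4) + u)
            (/-+-* (s / + 100) t) ⟩
  ((+ 1461 * s) / + 4 + t * + 146100) - (s / + 100 + t * + 4) + ((s / + 100) / + 4 + t)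
    ≡⟨ collect ((+ 1461 * s) / + 4) (s / + 100) ((s / + 100) / + 4) t ⟩
  daysBeforeYear s + t * + 146097 ∎
  where
  open ≡-Reasoning
  regroup₄ : ∀ s t → + 1461 * (s + t * + 400) ≡ + 1461 * s + t * + 146100 * + 4
  regroup₄ = solve-∀
  regroup₁₀₀ : ∀ s t → s + t * + 400 ≡ s + t * + 4 * + 100
  regroup₁₀₀ = solve-∀
  collect : ∀ a b c t → a + t * + 146100 - (b + t * + 4) + (c + t) ≡ a - b + c + t * + 146097
  collect = solve-∀

-- Checked by evaluation; both sides are invariant under y ↦ y + 400, which transfers it to all years.
daysBeforeYear-suc-residues :
  All (λ r → daysBeforeYear (+ r + + 1) ≡ daysBeforeYear (+ r) + + 365 + leapDay (+ r + + 1)) (upTo 400)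
daysBeforeYear-suc-residues = toWitness {a? = all? (λ r → _ ≟ _) (upTo 400)} _

daysBeforeYear-suc : ∀ y → daysBeforeYear (y + + 1) ≡ daysBeforeYear y + + 365 + leapDay (y + + 1)
daysBeforeYear-suc y = begin
  daysBeforeYear (y + + 1)
    ≡⟨ cong daysBeforeYear y+1≡ ⟩
  daysBeforeYear (+ r + + 1 + k * + 400)
    ≡⟨ daysBeforeYear-+400 (+ r + + 1) k ⟩
  daysBeforeYear (+ r + + 1) + k * + 146097
    ≡⟨ cong (_+ k * + 146097) (All.lookup daysBeforeYear-suc-residues (∈-upTo⁺ (n%d<d y (+ 400)))) ⟩
  daysBeforeYear (+ r) + + 365 + leapDay (+ r + + 1) + k * + 146097
    ≡⟨ swap (daysBeforeYear (+ r)) (leapDay (+ r + + 1)) (k * + 146097) ⟩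
  daysBeforeYear (+ r) + k * + 146097 + + 365 + leapDay (+ r + + 1)
    ≡⟨ cong₂ (λ u b → u + + 365 + (if b then + 1 else + 0))
             (daysBeforeYear-+400 (+ r) k) (isLeap-+400 (+ r + + 1) k) ⟨
  daysBeforeYear (+ r + k * + 400) + + 365 + leapDay (+ r + + 1 + k * + 400)
    ≡⟨ cong₂ (λ u v → daysBeforeYear u + + 365 + leapDay v) y≡ y+1≡ ⟨
  daysBeforeYear y + + 365 + leapDay (y + + 1) ∎
  where
  open ≡-Reasoning
  r = y % + 400
  k = y / + 400
  y≡ : y ≡ + r + k * + 400
  y≡ = a≡a%n+[a/n]*n y (+ 400)
  y+1≡ : y + + 1 ≡ + r + + 1 + k * + 400
  y+1≡ = trans (cong (_+ + 1) y≡) (reorder (+ r) k)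
    where
    reorder : ∀ r k → r + k * + 400 + + 1 ≡ r + + 1 + k * + 400
    reorder = solve-∀
  swap : ∀ a l c → a + + 365 + l + c ≡ a + c + + 365 + l
  swap = solve-∀

isLeap-periodic : ∀ {z} y → + 400 ∣ z → isLeap (y - z) ≡ isLeap y
isLeap-periodic {z} y 400∣z with ∣ᵤ⇒∣ {+ 400} {z} 400∣z
... | divides t refl = trans (cong isLeap (negate y t)) (isLeap-+400 y (- t))
  where
  negate : ∀ y t → y - t * + 400 ≡ y + - t * + 400
  negate = solve-∀

private
  +-literal-shift : ∀ a {b c b' c'} → b + c ≡ b' + c' + + 1 → a + b + c ≡ a + b' + c' + + 1
  +-literal-shift a {b} {c} {b'} {c'} eq = begin
    a + b + c                ≡⟨ +-assoc a b c ⟩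
    a + (b + c)              ≡⟨ cong (λ i → a + i) eq ⟩
    a + (b' + c' + + 1)      ≡⟨ solve (a ∷ b' ∷ c' ∷ []) ⟩
    a + b' + c' + + 1        ∎
    where open ≡-Reasoning

formula-sameMonth : ∀ z y m d → formula z (y , m , d + + 1) ≡ formula z (y , m , d) + + 1
formula-sameMonth z y m d =
  shift (daysBeforeYear (y - z - ind≤2 m)) (daysBeforeMonth (m + + 12 * ind≤2 m)) d
  where
  shift : ∀ a b d → a + b + (d + + 1 - + 1) ≡ a + b + (d - + 1) + + 1
  shift = solve-∀

formula-nextYear : ∀ z y → formula z (y + + 1 , + 1 , + 1) ≡ formula z (y , + 12 , + 31) + + 1
formula-nextYear z y =
  trans (cong (λ y₀ → daysBeforeYear y₀ + daysBeforeMonth (+ 13) + (+ 1 - + 1)) (previous y z))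
        (+-literal-shift (daysBeforeYear (y - z - + 0)) refl)
  where
  previous : ∀ y z → y + + 1 - z - + 1 ≡ y - z - + 0
  previous = solve-∀

-- The only use of 400 ∣ z: the computational year y − z is leap exactly when y is.
formula-endOfFebruary : ∀ {z} y → + 400 ∣ z →
  formula z (y , + 3 , + 1) ≡ formula z (y , + 2 , monthLength y (+ 2)) + + 1
formula-endOfFebruary {z} y 400∣z = begin
  daysBeforeYear (y - z - + 0) + daysBeforeMonth (+ 3) + (+ 1 - + 1)
    ≡⟨ cong (λ y₀ → daysBeforeYear y₀ + + 0 + + 0) (next-year-of y z) ⟩
  daysBeforeYear (w + + 1) + + 0 + + 0
    ≡⟨ cong (λ n → n + + 0 + + 0) (daysBeforeYear-suc w) ⟩
  daysBeforeYear w + + 365 + leapDay (w + + 1) + + 0 + + 0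
    ≡⟨ cong (λ b → daysBeforeYear w + + 365 + (if b then + 1 else + 0) + + 0 + + 0) leap-w+1 ⟩
  daysBeforeYear w + + 365 + leapDay y + + 0 + + 0
    ≡⟨ february (daysBeforeYear w) (isLeap y) ⟩
  daysBeforeYear w + daysBeforeMonth (+ 14) + (monthLength y (+ 2) - + 1) + + 1 ∎
  where
  open ≡-Reasoning
  w = y - z - + 1
  next-year-of : ∀ y z → y - z - + 0 ≡ y - z - + 1 + + 1
  next-year-of = solve-∀
  leap-w+1 : isLeap (w + + 1) ≡ isLeap y
  leap-w+1 = trans (cong isLeap (sym (next-year-of y z)))
                   (trans (cong isLeap (+-identityʳ (y - z))) (isLeap-periodic y 400∣z))
  february : ∀ a b → a + + 365 + (if b then + 1 else + 0) + + 0 + + 0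
                   ≡ a + + 337 + ((if b then + 29 else + 28) - + 1) + + 1
  february a true  = solve (a ∷ [])
  february a false = solve (a ∷ [])

-- Away from February both sides share the year term, and the remaining terms evaluate to numerals.
formula-nextMonth : ∀ {z} y m → + 400 ∣ z → + 1 ≤ m → m < + 12 →
  formula z (y , m + + 1 , + 1) ≡ formula z (y , m , monthLength y m) + + 1
formula-nextMonth {z} y (+ 1)  _ _ _ = +-literal-shift (daysBeforeYear (y - z - + 1)) refl
formula-nextMonth y (+ 2)  400∣z _ _ = formula-endOfFebruary y 400∣z
formula-nextMonth {z} y (+ 3)  _ _ _ = +-literal-shift (daysBeforeYear (y - z - + 0)) refl
formula-nextMonth {z} y (+ 4)  _ _ _ = +-literal-shift (daysBeforeYear (y - z - + 0)) refl
formula-nextMonth {z} y (+ 5)  _ _ _ = +-literal-shift (daysBeforeYear (y - z - + 0)) refl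
formula-nextMonth {z} y (+ 6)  _ _ _ = +-literal-shift (daysBeforeYear (y - z - + 0)) refl
formula-nextMonth {z} y (+ 7)  _ _ _ = +-literal-shift (daysBeforeYear (y - z - + 0)) refl
formula-nextMonth {z} y (+ 8)  _ _ _ = +-literal-shift (daysBeforeYear (y - z - + 0)) refl
formula-nextMonth {z} y (+ 9)  _ _ _ = +-literal-shift (daysBeforeYear (y - z - + 0)) refl
formula-nextMonth {z} y (+ 10) _ _ _ = +-literal-shift (daysBeforeYear (y - z - + 0)) refl
formula-nextMonth {z} y (+ 11) _ _ _ = +-literal-shift (daysBeforeYear (y - z - + 0)) refl
formula-nextMonth y (+ 0) _ (+≤+ ()) _
formula-nextMonth y -[1+ _ ] _ () _
formula-nextMonth y (+ suc (suc (suc (suc (suc (suc (suc (suc (suc (suc (suc (suc _))))))))))))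
  _ _ (+<+ (ℕ.s≤s (ℕ.s≤s (ℕ.s≤s (ℕ.s≤s (ℕ.s≤s (ℕ.s≤s (ℕ.s≤s (ℕ.s≤s (ℕ.s≤s (ℕ.s≤s (ℕ.s≤s (ℕ.s≤s ())))))))))))))

formula-nextDay : ∀ {z x x'} → + 400 ∣ z → InG x → NextDay x x' → formula z x' ≡ formula z x + + 1
formula-nextDay {z} {y , m , d} _ _ (sameMonth _) = formula-sameMonth z y m d
formula-nextDay {x = y , m , _} 400∣z x∈G (nextMonth m<12) =
  formula-nextMonth y m 400∣z (proj₁ (to (T-inGᵇ y m (monthLength y m)) x∈G)) m<12
formula-nextDay {z} {y , _ , _} _ _ nextYear = formula-nextYear z y

formula-epoch : ∀ z → formula z (z , + 3 , + 1) ≡ + 0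
formula-epoch z =
  cong (λ y₀ → daysBeforeYear y₀ + daysBeforeMonth (+ 3) + (+ 1 - + 1)) (self-difference z)
  where
  self-difference : ∀ z → z - z - + 0 ≡ + 0
  self-difference = solve-∀

rataDie-epoch≡formula : ∀ {z x} → + 400 ∣ z → T (inGgeᵇ (z , + 3 , + 1) x) →
  rataDie (inGgeᵇ (z , + 3 , + 1)) (z , + 3 , + 1) x ≡ formula z x
rataDie-epoch≡formula {z} {x} 400∣z x∈G₂ =
  trans (rataDie-≤ C (proj₂ (to (T-inGgeᵇ e x) x∈G₂)))
        (nextDay-induction z (λ x → + countInterval C e x ≡ formula z x) base step x x∈G₂)
  where
  e : Date
  e = (z , + 3 , + 1)
  C = inGgeᵇ e
  base : + countInterval C e e ≡ formula z e
  base = trans (cong +_ (countInterval-self C e)) (sym (formula-epoch z))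
  step : ∀ {x x'} → NextDay x x' → T (C x) → + countInterval C e x ≡ formula z x →
         + countInterval C e x' ≡ formula z x'
  step {x} {x'} next x∈G₂ ih = begin
    + countInterval C e x'          ≡⟨ cong +_ (countInterval-nextDay next x∈G₂) ⟩
    + suc (countInterval C e x)     ≡⟨ pos-+ 1 (countInterval C e x) ⟩
    + 1 + + countInterval C e x     ≡⟨ +-comm (+ 1) (+ countInterval C e x) ⟩
    + countInterval C e x + + 1     ≡⟨ cong (_+ + 1) ih ⟩
    formula z x + + 1               ≡⟨ formula-nextDay 400∣z (proj₁ (to (T-inGgeᵇ e x) x∈G₂)) next ⟨
    formula z x'                    ∎
    where open ≡-Reasoning

proposition6 : (z₂ : ℤ) → (+ 400) ∣ z₂ →
    (e₃ : Date) → T (inGgeᵇ (z₂ , + 3 , + 1) e₃) →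
    (x : Date) → T (inGgeᵇ (z₂ , + 3 , + 1) x) →
    rataDie (inGgeᵇ (z₂ , + 3 , + 1)) e₃ x
      ≡ formula z₂ x - rataDie (inGgeᵇ (z₂ , + 3 , + 1)) (z₂ , + 3 , + 1) e₃
proposition6 z₂ 400∣z₂ e₃ e₃∈G₂ x x∈G₂ = begin
  rataDie C e₃ x                    ≡⟨ rataDie-rebase C (proj₂ (to (T-inGgeᵇ e₂ e₃) e₃∈G₂))
                                                        (proj₂ (to (T-inGgeᵇ e₂ x) x∈G₂)) ⟩
  rataDie C e₂ x - rataDie C e₂ e₃  ≡⟨ cong (_- rataDie C e₂ e₃) (rataDie-epoch≡formula {z₂} {x} 400∣z₂ x∈G₂) ⟩
  formula z₂ x - rataDie C e₂ e₃    ∎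
  where
  open ≡-Reasoning
  e₂ : Date
  e₂ = (z₂ , + 3 , + 1)
  C = inGgeᵇ e₂
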